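{- Let $H$ be a connected graph of order $n_2\ge 3$ with no true twin vertices (no two distinct vertices $u,v$ with $N_H[u]=N_H[v]$), and let $n_1\ge 2$. Then $\dim(K_{n_1}\boxtimes H)=n_2(n_1-1)$.
   Context: $K_n$ is the complete graph of order $n$; $N_H[v]$ is the closed neighborhood. A set $S\subseteq V(G)$ of a connected graph $G$ is a metric generator if for every two distinct vertices $x,y$ there is $s\in S$ with $d_G(s,x)\ne d_G(s,y)$ (shortest-path distance); $\dim(G)$ is the minimum cardinality of a metric generator. The strong product $G\boxtimes H$ has vertex set $V(G)\times V(H)$, with $(a,b)$ and $(c,d)$ adjacent iff ($a=c$ and $bd\in E(H)$) or ($b=d$ and $ac\in E(G)$) or ($ac\in E(G)$ and $bd\in E(H)$). -}

module Defs where

open import Data.Nat using (ℕ; zero; suc; _≤_)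
open import Data.Fin using (Fin)
open import Data.Product using (_×_; _,_; ∃; ∃₂)
open import Data.Sum using (_⊎_)
open import Data.List using (List; length)
open import Data.List.Relation.Unary.Any using (Any)
open import Data.List.Relation.Unary.Unique.Propositional using (Unique)
open import Relation.Nullary using (¬_; Dec)
open import Relation.Binary.PropositionalEquality using (_≡_; _≢_)
open import Function.Bundles using (_⇔_)

record Graph (V : Set) : Set₁ where
  field
    Adj        : V → V → Set
    adj-sym    : ∀ {u v} → Adj u v → Adj v u
    adj-irrefl : ∀ {u} → ¬ Adj u u
    adj?       : ∀ u v → Dec (Adj u v)
open Graph public

module _ {V : Set} (G : Graph V) where

  data Walk : V → V → ℕ → Set where
    nil  : ∀ {u} → Walk u u 0
    cons : ∀ {u w v k} → Adj G u w → Walk w v k → Walk u v (suc k)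

  Connected : Set
  Connected = ∀ u v → ∃ λ k → Walk u v k

  Dist : V → V → ℕ → Set
  Dist u v k = Walk u v k × (∀ j → Walk u v j → k ≤ j)

  Resolves : V → V → V → Set
  Resolves s x y = ∃₂ λ k l → Dist s x k × Dist s y l × k ≢ l

  IsMetricGenerator : List V → Set
  IsMetricGenerator S = ∀ x y → x ≢ y → Any (λ s → Resolves s x y) S

  MetricDim : ℕ → Set
  MetricDim d =
    (∃ λ S → Unique S × IsMetricGenerator S × length S ≡ d)
    × (∀ S → Unique S → IsMetricGenerator S → d ≤ length S)

  ClosedNbhd : V → V → Set
  ClosedNbhd v w = w ≡ v ⊎ Adj G v w

  NoTrueTwins : Set
  NoTrueTwins = ∀ u v → u ≢ v → ¬ (∀ w → ClosedNbhd u w ⇔ ClosedNbhd v w)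

open import Relation.Nullary using (yes; no)
open import Relation.Nullary.Decidable using (¬?)
open import Data.Fin.Properties using (_≟_)
open import Data.Product using (proj₁; proj₂)
open import Data.Sum using (inj₁; inj₂)
open import Relation.Nullary.Decidable using (_×-dec_; _⊎-dec_)
open import Relation.Binary.PropositionalEquality using (refl; sym)

K : (n : ℕ) → Graph (Fin n)
K n = record
  { Adj = λ a b → a ≢ b
  ; adj-sym = λ p q → p (sym q)
  ; adj-irrefl = λ p → p refl
  ; adj? = λ a b → ¬? (a ≟ b)
  }

_⊠_ : {m n : ℕ} → Graph (Fin m) → Graph (Fin n) → Graph (Fin m × Fin n)
_⊠_ {m} {n} G H = record
  { Adj = SAdj
  ; adj-sym = sy
  ; adj-irrefl = irr
  ; adj? = dec
  }
  where
  SAdj : Fin m × Fin n → Fin m × Fin n → Set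
  SAdj (a , b) (c , d) =
    (a ≡ c × Adj H b d) ⊎ (b ≡ d × Adj G a c) ⊎ (Adj G a c × Adj H b d)
  sy : ∀ {u v} → SAdj u v → SAdj v u
  sy (inj₁ (e , h)) = inj₁ (sym e , adj-sym H h)
  sy (inj₂ (inj₁ (e , g))) = inj₂ (inj₁ (sym e , adj-sym G g))
  sy (inj₂ (inj₂ (g , h))) = inj₂ (inj₂ (adj-sym G g , adj-sym H h))
  irr : ∀ {u} → ¬ SAdj u u
  irr (inj₁ (_ , h)) = adj-irrefl H h
  irr (inj₂ (inj₁ (_ , g))) = adj-irrefl G g
  irr (inj₂ (inj₂ (g , _))) = adj-irrefl G g
  dec : ∀ u v → Dec (SAdj u v)
  dec (a , b) (c , d) =
    ((a ≟ c) ×-dec adj? H b d) ⊎-dec (((b ≟ d) ×-dec adj? G a c) ⊎-dec (adj? G a c ×-dec adj? H b d))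

-- The vertices (a, b) and (c, b) of one K-fibre of K n₁ ⊠ H have the same closed
-- neighbourhood, so only they themselves can tell them apart: a metric generator
-- must contain all but at most one vertex of each of the n₂ fibres.  Conversely,
-- the vertices outside the layer a = 0 form a metric generator: such a vertex
-- resolves every pair containing it, and (0, b) ≠ (0, d) are separated by (1, w)
-- for any w lying in exactly one of N_H[b], N_H[d], which exists because H has
-- no true twins.
module Submission where

open import Defs
open import Data.Nat using (ℕ; zero; suc; _≤_; _<_; _*_; _∸_; z≤n; s≤s)
open import Data.Nat.Properties using (≤-refl; ≤-trans; ≤-<-trans; ≤-antisym; <⇒≢; ≮⇒≥; m<1+n⇒m<n∨m≡n)
open import Data.Fin using (Fin; zero; suc; punchIn; remQuot; combine)
open import Data.Fin.Properties
  using (any?; ¬∀⟶∃¬; injective⇒≤; punchIn-injective; punchInᵢ≢i; remQuot-combine; combine-remQuot)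
  renaming (_≟_ to _≟ᶠ_)
open import Data.Product using (∃; _×_; _,_; proj₁; proj₂; uncurry)
open import Data.Product.Properties using (≡-dec)
open import Data.Sum using (_⊎_; inj₁; inj₂; [_,_])
open import Data.Empty using (⊥-elim)
open import Data.List using (List; length; lookup; tabulate)
open import Data.List.Relation.Unary.Any using (index)
open import Data.List.Relation.Unary.Any.Properties using (lookup-index)
open import Data.List.Membership.Propositional using (_∈_; find; lose)
open import Data.List.Membership.Propositional.Properties using (∈-tabulate⁺)
open import Data.List.Relation.Unary.Unique.Propositional using (Unique)
open import Data.List.Relation.Unary.Unique.Propositional.Properties using (tabulate⁺)
open import Data.List.Properties using (length-tabulate)
open import Function using (_∘_; id)
open import Function.Bundles using (_⇔_; mk⇔; Equivalence)
open import Function.Definitions using (Injective)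
import Function.Properties.Equivalence as ⇔
open import Relation.Nullary using (¬_; Dec; yes; no)
open import Relation.Nullary.Decidable using (_⊎-dec_; _×-dec_; _→-dec_; ¬?; map′; decidable-stable)
open import Relation.Unary using (Decidable)
open import Relation.Binary.Definitions using (DecidableEquality)
open import Relation.Binary.PropositionalEquality using (_≡_; _≢_; refl; sym; cong; subst; module ≡-Reasoning)

module _ {P : ℕ → Set} (P? : Decidable P) where

  private
    leastBelow : ∀ n → (∀ j → j < n → ¬ P j) ⊎ (∃ λ k → P k × (∀ j → P j → k ≤ j))
    leastBelow zero = inj₁ λ _ ()
    leastBelow (suc n) with leastBelow n
    ... | inj₂ found = inj₂ found
    ... | inj₁ none with P? n
    ...   | yes pn = inj₂ (n , pn , λ j pj → ≮⇒≥ λ j<n → none j j<n pj)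
    ...   | no ¬pn = inj₁ λ j j<1+n →
      [ none j , (λ { refl → ¬pn }) ] (m<1+n⇒m<n∨m≡n j<1+n)

  least : ∀ {n} → P n → ∃ λ k → P k × (∀ j → P j → k ≤ j)
  least {n} pn with leastBelow (suc n)
  ... | inj₁ none = ⊥-elim (none n ≤-refl pn)
  ... | inj₂ found = found

module _ {V : Set} (G : Graph V) where

  TrueTwins : V → V → Set
  TrueTwins u v = ∀ w → ClosedNbhd G u w ⇔ ClosedNbhd G v w

  closedNbhd-sym : ∀ {u w} → ClosedNbhd G u w → ClosedNbhd G w u
  closedNbhd-sym (inj₁ refl) = inj₁ refl
  closedNbhd-sym (inj₂ uw) = inj₂ (adj-sym G uw)

  closedNbhd⇒walk : ∀ {u v} → ClosedNbhd G u v → ∃ λ k → k ≤ 1 × Walk G u v k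
  closedNbhd⇒walk (inj₁ refl) = 0 , z≤n , nil
  closedNbhd⇒walk (inj₂ uv) = 1 , ≤-refl , cons uv nil

  walk-length>0 : ∀ {u v k} → u ≢ v → Walk G u v k → 0 < k
  walk-length>0 u≢u nil = ⊥-elim (u≢u refl)
  walk-length>0 _ (cons _ _) = s≤s z≤n

  walk-length>1 : ∀ {u v k} → ¬ ClosedNbhd G u v → Walk G u v k → 1 < k
  walk-length>1 ∉N[u] nil = ⊥-elim (∉N[u] (inj₁ refl))
  walk-length>1 ∉N[u] (cons uv nil) = ⊥-elim (∉N[u] (inj₂ uv))
  walk-length>1 _ (cons _ (cons _ _)) = s≤s (s≤s z≤n)

  -- The vertex before v on the walk lies in N[v] ⊆ N[u], so the walk can end at u instead.
  walk-redirect : ∀ {u v s j} → (∀ w → ClosedNbhd G v w → ClosedNbhd G u w) →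
    Walk G s v (suc j) → ∃ λ i → i ≤ suc j × Walk G s u i
  walk-redirect N[v]⊆N[u] (cons {u = s} sv nil) with N[v]⊆N[u] s (inj₂ (adj-sym G sv))
  ... | inj₁ refl = 0 , z≤n , nil
  ... | inj₂ us = 1 , ≤-refl , cons (adj-sym G us) nil
  walk-redirect N[v]⊆N[u] (cons sw walk@(cons _ _)) with walk-redirect N[v]⊆N[u] walk
  ... | i , i≤j , walk′ = suc i , s≤s i≤j , cons sw walk′

  dist-mono : ∀ {u v s k l} → (∀ w → ClosedNbhd G v w → ClosedNbhd G u w) → s ≢ v →
    Dist G s u k → Dist G s v l → k ≤ l
  dist-mono _ s≢s _ (nil , _) = ⊥-elim (s≢s refl)
  dist-mono N[v]⊆N[u] _ (_ , shortest) (walk@(cons _ _) , _) with walk-redirect N[v]⊆N[u] walk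
  ... | i , i≤l , walk′ = ≤-trans (shortest i walk′) i≤l

  twins-unresolved : ∀ {u v s} → TrueTwins u v → s ≢ u → s ≢ v → ¬ Resolves G s u v
  twins-unresolved twins s≢u s≢v (k , l , du , dv , k≢l) = k≢l (≤-antisym
    (dist-mono (λ w → Equivalence.from (twins w)) s≢v du dv)
    (dist-mono (λ w → Equivalence.to (twins w)) s≢u dv du))

  resolves-sym : ∀ {s x y} → Resolves G s x y → Resolves G s y x
  resolves-sym (k , l , dx , dy , k≢l) = l , k , dy , dx , k≢l ∘ sym

module Distances {V : Set} (G : Graph V) (_≟_ : DecidableEquality V)
  (search : ∀ {P : V → Set} → Decidable P → Dec (∃ P)) (connected : Connected G) where

  walk? : ∀ k u v → Dec (Walk G u v k)
  walk? zero u v with u ≟ v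
  ... | yes refl = yes nil
  ... | no u≢v = no λ { nil → u≢v refl }
  walk? (suc k) u v with search (λ w → adj? G u w ×-dec walk? k w v)
  ... | yes (w , uw , walk) = yes (cons uw walk)
  ... | no none = no λ { (cons uw walk) → none (_ , uw , walk) }

  dist : ∀ u v → ∃ (Dist G u v)
  dist u v = least (λ k → walk? k u v) (proj₂ (connected u v))

  resolves : ∀ {s x y} → (∀ {k l} → Dist G s x k → Dist G s y l → k < l) → Resolves G s x y
  resolves {s} {x} {y} k<l with dist s x | dist s y
  ... | k , dx | l , dy = k , l , dx , dy , <⇒≢ (k<l dx dy)

  resolves-self : ∀ {x y} → x ≢ y → Resolves G x x y
  resolves-self x≢y = resolves λ (_ , shortest) (walk , _) →
    ≤-<-trans (shortest 0 nil) (walk-length>0 G x≢y walk)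

  resolves-closedNbhd : ∀ {s x y} → ClosedNbhd G s x → ¬ ClosedNbhd G s y → Resolves G s x y
  resolves-closedNbhd x∈N[s] y∉N[s] with closedNbhd⇒walk G x∈N[s]
  ... | j , j≤1 , walk = resolves λ (_ , shortest) (walk′ , _) →
    ≤-<-trans (≤-trans (shortest j walk) j≤1) (walk-length>1 G y∉N[s] walk′)

module _ {m n : ℕ} (H : Graph (Fin n)) where

  closedNbhd-K⊠ : ∀ {a b c d} → ClosedNbhd (K m ⊠ H) (a , b) (c , d) ⇔ ClosedNbhd H b d
  closedNbhd-K⊠ {a} {b} {c} {d} = mk⇔ to from
    where
    to : ClosedNbhd (K m ⊠ H) (a , b) (c , d) → ClosedNbhd H b d
    to (inj₁ refl) = inj₁ refl
    to (inj₂ (inj₁ (_ , bd))) = inj₂ bd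
    to (inj₂ (inj₂ (inj₁ (refl , _)))) = inj₁ refl
    to (inj₂ (inj₂ (inj₂ (_ , bd)))) = inj₂ bd
    from : ClosedNbhd H b d → ClosedNbhd (K m ⊠ H) (a , b) (c , d)
    from d∈N[b] with a ≟ᶠ c | d∈N[b]
    ... | yes refl | inj₁ refl = inj₁ refl
    ... | no a≢c | inj₁ refl = inj₂ (inj₂ (inj₁ (refl , a≢c)))
    ... | yes a≡c | inj₂ bd = inj₂ (inj₁ (a≡c , bd))
    ... | no a≢c | inj₂ bd = inj₂ (inj₂ (inj₂ (a≢c , bd)))

  fibre-twins : ∀ {a c b} → TrueTwins (K m ⊠ H) (a , b) (c , b)
  fibre-twins (_ , _) = ⇔.trans closedNbhd-K⊠ (⇔.sym closedNbhd-K⊠)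

  inFibre : ∀ {a b d k} → Walk H b d k → Walk (K m ⊠ H) (a , b) (a , d) k
  inFibre nil = nil
  inFibre (cons bw walk) = cons (inj₁ (refl , bw)) (inFibre walk)

  K⊠-connected : Connected H → Connected (K m ⊠ H)
  K⊠-connected connected (a , b) (c , d) with proj₂ (connected b d) | a ≟ᶠ c
  ... | walk | yes refl = _ , inFibre walk
  ... | walk | no a≢c = _ , cons (inj₂ (inj₁ (refl , a≢c))) (inFibre walk)

_⇔-dec_ : ∀ {A B : Set} → Dec A → Dec B → Dec (A ⇔ B)
A? ⇔-dec B? = map′ (uncurry mk⇔) (λ A⇔B → Equivalence.to A⇔B , Equivalence.from A⇔B)
  ((A? →-dec B?) ×-dec (B? →-dec A?))

module _ {n} (G : Graph (Fin n)) where

  closedNbhd? : ∀ u w → Dec (ClosedNbhd G u w)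
  closedNbhd? u w = (w ≟ᶠ u) ⊎-dec adj? G u w

  twin-witness : ∀ {u v} → ¬ TrueTwins G u v →
    ∃ λ w → (ClosedNbhd G u w × ¬ ClosedNbhd G v w) ⊎ (ClosedNbhd G v w × ¬ ClosedNbhd G u w)
  twin-witness {u} {v} ¬twins
    with ¬∀⟶∃¬ n _ (λ w → closedNbhd? u w ⇔-dec closedNbhd? v w) ¬twins
  ... | w , ¬⇔ with closedNbhd? u w | closedNbhd? v w
  ...   | yes w∈N[u] | yes w∈N[v] = ⊥-elim (¬⇔ (mk⇔ (λ _ → w∈N[v]) (λ _ → w∈N[u])))
  ...   | no w∉N[u] | no w∉N[v] = ⊥-elim (¬⇔ (mk⇔ (⊥-elim ∘ w∉N[u]) (⊥-elim ∘ w∉N[v])))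
  ...   | yes w∈N[u] | no w∉N[v] = w , inj₁ (w∈N[u] , w∉N[v])
  ...   | no w∉N[u] | yes w∈N[v] = w , inj₂ (w∈N[v] , w∉N[u])

injection⇒≤length : ∀ {A : Set} {xs : List A} {k} {f : Fin k → A} →
  Injective _≡_ _≡_ f → (∀ i → f i ∈ xs) → k ≤ length xs
injection⇒≤length {xs = xs} {f = f} f-injective f∈xs =
  injective⇒≤ {f = index ∘ f∈xs} λ {i} {j} same-index → f-injective (begin
    f i                          ≡⟨ lookup-index (f∈xs i) ⟩
    lookup xs (index (f∈xs i))   ≡⟨ cong (lookup xs) same-index ⟩
    lookup xs (index (f∈xs j))   ≡⟨ lookup-index (f∈xs j) ⟨
    f j                          ∎)
  where open ≡-Reasoning

remQuot-injective : ∀ {n} m → Injective _≡_ _≡_ (remQuot {n} m)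
remQuot-injective {n} m {k} {k′} eq = begin
  k                                   ≡⟨ combine-remQuot {n} m k ⟨
  uncurry combine (remQuot {n} m k)   ≡⟨ cong (uncurry combine) eq ⟩
  uncurry combine (remQuot {n} m k′)  ≡⟨ combine-remQuot {n} m k′ ⟩
  k′                                  ∎
  where open ≡-Reasoning

-- The vertices (a, b) with a ≢ skip b; index combine b i is the i-th of them in the fibre over b.
fibresAvoiding : ∀ {m n} → (Fin n → Fin (suc m)) → Fin (n * m) → Fin (suc m) × Fin n
fibresAvoiding {m} {n} skip k =
  punchIn (skip (proj₁ (remQuot {n} m k))) (proj₂ (remQuot {n} m k)) , proj₁ (remQuot {n} m k)

fibresAvoiding-injective : ∀ {m n} (skip : Fin n → Fin (suc m)) → Injective _≡_ _≡_ (fibresAvoiding skip)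
fibresAvoiding-injective {m} {n} skip = remQuot-injective {n} m ∘ pair-injective
  where
  pair-injective : ∀ {b b′ i i′} →
    (punchIn (skip b) i , b) ≡ (punchIn (skip b′) i′ , b′) → (b , i) ≡ (b′ , i′)
  pair-injective eq with refl ← cong proj₂ eq = cong (_ ,_) (punchIn-injective _ _ _ (cong proj₁ eq))

fibresAvoiding-combine : ∀ {m n} (skip : Fin n → Fin (suc m)) b i →
  fibresAvoiding skip (combine b i) ≡ (punchIn (skip b) i , b)
fibresAvoiding-combine {m} {n} skip b i =
  cong (λ (b , i) → punchIn (skip b) i , b) (remQuot-combine {n} {m} b i)

module _ {m n : ℕ} (H : Graph (Fin n)) (S : List (Fin (suc m) × Fin n))
  (generator : IsMetricGenerator (K (suc m) ⊠ H) S) where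

  private
    _≟_ : DecidableEquality (Fin (suc m) × Fin n)
    _≟_ = ≡-dec _≟ᶠ_ _≟ᶠ_
    open import Data.List.Membership.DecPropositional _≟_ using (_∈?_)

  fibre-pair∈ : ∀ {a c b} → a ≢ c → (a , b) ∈ S ⊎ (c , b) ∈ S
  fibre-pair∈ {a} {c} {b} a≢c with find (generator (a , b) (c , b) (a≢c ∘ cong proj₁))
  ... | s , s∈S , s-resolves with s ≟ (a , b) | s ≟ (c , b)
  ...   | yes refl | _ = inj₁ s∈S
  ...   | no _ | yes refl = inj₂ s∈S
  ...   | no s≢ab | no s≢cb = ⊥-elim (twins-unresolved _ (fibre-twins H) s≢ab s≢cb s-resolves)

  fibre-almost⊆ : ∀ b → ∃ λ a → ∀ i → (punchIn a i , b) ∈ S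
  fibre-almost⊆ b with any? (λ a → ¬? ((a , b) ∈? S))
  ... | yes (a , ab∉S) = a , λ i → [ ⊥-elim ∘ ab∉S , id ] (fibre-pair∈ (punchInᵢ≢i a i ∘ sym))
  ... | no none∉S = zero , λ i → decidable-stable (_ ∈? S) (λ ∉S → none∉S (_ , ∉S))

  metricGenerator-length : n * m ≤ length S
  metricGenerator-length = injection⇒≤length
    (fibresAvoiding-injective (proj₁ ∘ fibre-almost⊆)) (λ k → proj₂ (fibre-almost⊆ _) _)

module _ {m n : ℕ} where

  outsideLayer0 : List (Fin (suc (suc m)) × Fin n)
  outsideLayer0 = tabulate (fibresAvoiding (λ _ → zero))

  outsideLayer0-unique : Unique outsideLayer0
  outsideLayer0-unique = tabulate⁺ (fibresAvoiding-injective (λ _ → zero))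

  outsideLayer0-length : length outsideLayer0 ≡ n * suc m
  outsideLayer0-length = length-tabulate _

  ∈-outsideLayer0 : ∀ i b → (suc i , b) ∈ outsideLayer0
  ∈-outsideLayer0 i b =
    subst (_∈ outsideLayer0) (fibresAvoiding-combine (λ _ → zero) b i) (∈-tabulate⁺ (combine b i))

module _ {m n : ℕ} (H : Graph (Fin n)) (connected : Connected H) (noTwins : NoTrueTwins H) where

  private
    P : Graph (Fin (suc (suc m)) × Fin n)
    P = K (suc (suc m)) ⊠ H

    search : ∀ {Q : Fin (suc (suc m)) × Fin n → Set} → Decidable Q → Dec (∃ Q)
    search Q? = map′ (λ (a , b , q) → (a , b) , q) (λ ((a , b) , q) → a , b , q)
      (any? λ a → any? λ b → Q? (a , b))

  open Distances P (≡-dec _≟ᶠ_ _≟ᶠ_) search (K⊠-connected H connected)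

  separatesLayer0 : ∀ {b d w} → ClosedNbhd H b w → ¬ ClosedNbhd H d w →
    Resolves P (suc zero , w) (zero , b) (zero , d)
  separatesLayer0 w∈N[b] w∉N[d] = resolves-closedNbhd
    (Equivalence.from (closedNbhd-K⊠ H) (closedNbhd-sym H w∈N[b]))
    (w∉N[d] ∘ closedNbhd-sym H ∘ Equivalence.to (closedNbhd-K⊠ H))

  outsideLayer0-generator : IsMetricGenerator P outsideLayer0
  outsideLayer0-generator (suc i , b) _ x≢y = lose (∈-outsideLayer0 i b) (resolves-self x≢y)
  outsideLayer0-generator (zero , _) (suc j , d) x≢y =
    lose (∈-outsideLayer0 j d) (resolves-sym P (resolves-self (x≢y ∘ sym)))
  outsideLayer0-generator (zero , b) (zero , d) x≢y
    with twin-witness H (noTwins b d (x≢y ∘ cong (zero ,_)))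
  ... | w , inj₁ (w∈N[b] , w∉N[d]) =
    lose (∈-outsideLayer0 zero w) (separatesLayer0 w∈N[b] w∉N[d])
  ... | w , inj₂ (w∈N[d] , w∉N[b]) =
    lose (∈-outsideLayer0 zero w) (resolves-sym P (separatesLayer0 w∈N[d] w∉N[b]))

corollary3 : (n₁ n₂ : ℕ) (H : Graph (Fin n₂)) →
    3 ≤ n₂ → Connected H → NoTrueTwins H → 2 ≤ n₁ →
    MetricDim (K n₁ ⊠ H) (n₂ * (n₁ ∸ 1))
corollary3 (suc (suc m)) n₂ H _ connected noTwins _ =
  ( outsideLayer0
  , outsideLayer0-unique
  , outsideLayer0-generator H connected noTwins
  , outsideLayer0-length {n = n₂} )
  , λ S _ generator → metricGenerator-length H S generator
corollary3 (suc zero) _ _ _ _ _ (s≤s ())
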